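{- Let $G$ be a looped simple graph and $r$ the rank function of $M(IAS(G))$. Suppose $S$ is a subtransversal of $W(G)$ with $|S|=|V(G)|-1$, and let $v$ be the vertex of $G$ with $v_\phi,v_\chi,v_\psi\notin S$. Let $S_\phi=S\cup\{v_\phi\}$, $S_\chi=S\cup\{v_\chi\}$, $S_\psi=S\cup\{v_\psi\}$. Then one of $S_\phi,S_\chi,S_\psi$ has rank $r(S)$, and the other two have rank $r(S)+1$.
   Context: A looped simple graph is a finite graph in which each vertex may carry at most one loop and distinct non-loop edges join distinct pairs of vertices. $A(G)$ is the adjacency matrix over $GF(2)$ (diagonal $1$ iff looped). $M(IAS(G))$ is the binary matroid represented by the columns of $(I\mid A(G)\mid I+A(G))$; its ground set $W(G)$ consists of columns $w_\phi,w_\chi,w_\psi$ for $w\in V(G)$, the columns of $w$ in $I$, $A(G)$, $I+A(G)$. A subtransversal of $W(G)$ is a subset $S\subseteq W(G)$ with $|S\cap\{w_\phi,w_\chi,w_\psi\}|\le 1$ for all $w\in V(G)$. -}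

module Defs where

open import Data.Nat using (ℕ; zero; suc; _+_; _∸_)
open import Data.Fin using (Fin; zero; suc; _≟_)
open import Data.Bool using (Bool; true; false; _xor_; if_then_else_)
open import Data.Product using (_×_; _,_; Σ)
open import Relation.Nullary using (¬_)
open import Relation.Nullary.Decidable using (⌊_⌋)
open import Relation.Binary.PropositionalEquality using (_≡_)

-- A looped simple graph on vertex set Fin n, given by its adjacency matrix
-- over GF(2) = Bool (true = 1).  Diagonal entry true iff the vertex is looped.
record LoopedSimpleGraph (n : ℕ) : Set where
  field
    adj       : Fin n → Fin n → Bool
    symmetric : ∀ i j → adj i j ≡ adj j i
open LoopedSimpleGraph public

-- The three column types φ (column of I), χ (column of A(G)), ψ (column of I+A(G)).
data Tag : Set where
  φ χ ψ : Tag

W : ℕ → Set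
W n = Fin n × Tag

Vec2 : ℕ → Set
Vec2 n = Fin n → Bool

zeroV : ∀ {n} → Vec2 n
zeroV _ = false

_⊕_ : ∀ {n} → Vec2 n → Vec2 n → Vec2 n
(u ⊕ v) i = u i xor v i

idM : ∀ {n} → Fin n → Fin n → Bool
idM i j = ⌊ i ≟ j ⌋

column : ∀ {n} → LoopedSimpleGraph n → W n → Vec2 n
column G (w , φ) i = idM i w
column G (w , χ) i = adj G i w
column G (w , ψ) i = idM i w xor adj G i w

SubsetW : ℕ → Set
SubsetW n = W n → Bool

_⊆W_ : ∀ {n} → SubsetW n → SubsetW n → Set
X ⊆W Y = ∀ w → X w ≡ true → Y w ≡ true

insertW : ∀ {n} → SubsetW n → W n → SubsetW n
insertW {n} X (w , t) (w' , t') with ⌊ w ≟ w' ⌋ | t | t'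
... | true | φ | φ = true
... | true | χ | χ = true
... | true | ψ | ψ = true
... | _ | _ | _ = X (w' , t')

sumFinV : ∀ {m} (n : ℕ) → (Fin n → Vec2 m) → Vec2 m
sumFinV zero f = zeroV
sumFinV (suc n) f = f zero ⊕ sumFinV n (λ i → f (suc i))

sumFinN : (n : ℕ) → (Fin n → ℕ) → ℕ
sumFinN zero f = 0
sumFinN (suc n) f = f zero + sumFinN n (λ i → f (suc i))

b2n : Bool → ℕ
b2n true = 1
b2n false = 0

size : ∀ {n} → SubsetW n → ℕ
size {n} X = sumFinN n (λ w → b2n (X (w , φ)) + b2n (X (w , χ)) + b2n (X (w , ψ)))

sumCols : ∀ {n} → LoopedSimpleGraph n → SubsetW n → Vec2 n
sumCols {n} G T = sumFinV n (λ w →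
  (if T (w , φ) then column G (w , φ) else zeroV) ⊕
  ((if T (w , χ) then column G (w , χ) else zeroV) ⊕
   (if T (w , ψ) then column G (w , ψ) else zeroV)))

Independent : ∀ {n} → LoopedSimpleGraph n → SubsetW n → Set
Independent G Y = ∀ T → T ⊆W Y → (∀ i → sumCols G T i ≡ false) → ∀ w → T w ≡ false

IsRank : ∀ {n} → LoopedSimpleGraph n → SubsetW n → ℕ → Set
IsRank G X k =
  Σ (SubsetW _) (λ Y → Y ⊆W X × Independent G Y × size Y ≡ k) ×
  (∀ Y → Y ⊆W X → Independent G Y → size Y Data.Nat.≤ k)
  where import Data.Nat

Subtransversal : ∀ {n} → SubsetW n → Set
Subtransversal S = ∀ w t t' → S (w , t) ≡ true → S (w , t') ≡ true → t ≡ t'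

-- For a subset D of W(G) put p(D)_u = [u_φ ∈ D] + [u_ψ ∈ D] and q(D)_u = [u_χ ∈ D] + [u_ψ ∈ D]; the columns
-- of D then sum to p(D) + A q(D). As A is symmetric, q(D)·Σ(E) + q(E)·Σ(D) = Σ_u ω(D_u, E_u) for the
-- alternating form ω on GF(2)² in which φ, χ, ψ are the three nonzero vectors. So ω vanishes wherever D ∪ E is
-- a subtransversal, and equals 1 at a vertex where D and E use two different tags.
--
-- Let Y be a basis of S and N = S ∖ Y, so |Y| + |N| = n − 1. Each s ∈ N closes a circuit D_s ⊆ Y ∪ {s}; the
-- vectors q(D_s) are independent and orthogonal to every column of a subtransversal containing S, so every
-- independent subset of S ∪ {v_t} has at most n − |N| = |Y| + 1 elements, and at most |Y| if Y spans v_t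
-- (then D_{v_t} joins the circuits). Two tags t ≠ t′ with v_t, v_t′ spanned by Y would give circuits with
-- pairing 0 but ω-sum ω(t, t′) = 1; if no v_t were spanned, Y ∪ {v_φ, v_χ} would be independent (as
-- col v_ψ = col v_φ + col v_χ) and too large. So exactly one v_t is spanned by Y.

module Submission where

open import Defs
open import Data.Nat using (ℕ; suc; _∸_)
open import Data.Fin using (Fin)
open import Data.Bool using (false)
open import Data.Product using (Σ; _×_; _,_)
open import Relation.Nullary using (¬_)
open import Relation.Binary.PropositionalEquality using (_≡_)

open import Algebra.Bundles using (CommutativeMonoid; CommutativeRing)
import Algebra.Properties.Monoid.Sum
import Algebra.Properties.Semiring.Sum
open import Data.Bool using (Bool; true; not; _∧_; _∨_; _xor_; if_then_else_)
open import Data.Bool.Properties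
  using (xor-∧-commutativeRing; ∧-zeroʳ; ∧-identityʳ; ∨-zeroʳ; ∨-identityʳ; xor-same; xor-identityʳ; ¬-not;
         xor-assoc; xor-comm; ∧-comm; ∧-assoc; ∧-distribˡ-xor; ∧-distribʳ-xor)
import Data.Bool.Properties as Bool
open import Data.Empty using (⊥)
open import Data.Fin using (zero; suc; punchIn; _≟_)
open import Data.Fin.Properties using (punchInᵢ≢i; any?; all?)
open import Data.Fin.Subset using (Subset)
open import Data.Fin.Subset.Properties using (anySubset?)
open import Data.Maybe using (Maybe; just; nothing)
open import Data.Nat using (zero; _+_; _≤_; z≤n; s≤s)
open import Data.Nat.Properties
  using (+-0-commutativeMonoid; +-0-monoid; ≤-refl; ≤-reflexive; ≤-trans; +-monoˡ-≤; +-monoʳ-≤; +-suc; +-comm;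
         m≤n⇒m≤1+n; +-cancelʳ-≤; ≤-pred; 1+n≰n; module ≤-Reasoning)
open import Data.Product using (proj₁; proj₂)
open import Data.Product.Properties using (≡-dec; ,-injectiveˡ; ,-injectiveʳ)
open import Data.Sum using (_⊎_; inj₁; inj₂)
open import Data.Vec using (lookup; tabulate)
open import Data.Vec.Functional using (tail)
open import Data.Vec.Properties using (lookup∘tabulate)
open import Function using (_∘_; id)
open import Level using (0ℓ)
open import Relation.Binary.Definitions using (DecidableEquality)
open import Relation.Binary.PropositionalEquality using (refl; sym; trans; cong; cong₂; subst; subst₂; _≢_; module ≡-Reasoning)
open import Relation.Nullary using (Dec; yes; no; contradiction)
open import Relation.Nullary.Decidable using (⌊_⌋; map′; _×-dec_; _→-dec_)
open import Tactic.RingSolver using (solve-∀)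
open import Tactic.RingSolver.Core.AlmostCommutativeRing using (AlmostCommutativeRing; fromCommutativeRing)

-- Sums indexed by W m

module SumOverW {c ℓ} (M : CommutativeMonoid c ℓ) where
  open CommutativeMonoid M renaming (refl to ≈-refl; sym to ≈-sym; trans to ≈-trans)
  open import Algebra.Properties.CommutativeMonoid.Sum M
  open import Algebra.Solver.CommutativeMonoid M using (solve; _⊜_) renaming (_⊕_ to _⊞_)
  open import Relation.Binary.Reasoning.Setoid setoid

  ∑Tag : (Tag → Carrier) → Carrier
  ∑Tag h = h φ ∙ h χ ∙ h ψ

  ∑W : ∀ {m} → (W m → Carrier) → Carrier
  ∑W {m} g = ∑[ w < m ] ∑Tag (λ t → g (w , t))

  ∑Tag-distrib : ∀ (g h : Tag → Carrier) → ∑Tag (λ t → g t ∙ h t) ≈ ∑Tag g ∙ ∑Tag h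
  ∑Tag-distrib g h = solve 6 (λ a b c d e f → (((a ⊞ b) ⊞ (c ⊞ d)) ⊞ (e ⊞ f)) ⊜ (((a ⊞ c) ⊞ e) ⊞ ((b ⊞ d) ⊞ f))) ≈-refl
    (g φ) (h φ) (g χ) (h χ) (g ψ) (h ψ)

  ∑W-cong : ∀ {m} {g h : W m → Carrier} → (∀ e → g e ≈ h e) → ∑W g ≈ ∑W h
  ∑W-cong {m} g≈h = sum-cong-≋ {m} (λ w → ∙-cong (∙-cong (g≈h (w , φ)) (g≈h (w , χ))) (g≈h (w , ψ)))

  ∑W-distrib : ∀ {m} (g h : W m → Carrier) → ∑W (λ e → g e ∙ h e) ≈ ∑W g ∙ ∑W h
  ∑W-distrib {m} g h = ≈-trans (sum-cong-≋ {m} (λ w → ∑Tag-distrib (λ t → g (w , t)) (λ t → h (w , t))))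
    (∑-distrib-+ (λ w → ∑Tag (λ t → g (w , t))) (λ w → ∑Tag (λ t → h (w , t))))

  sum-single : ∀ {m} (f : Fin m → Carrier) (j : Fin m) → (∀ i → j ≢ i → f i ≈ ε) → sum f ≈ f j
  sum-single {suc m} f j f≈0 = begin
    sum f                                ≈⟨ sum-remove f ⟩
    f j ∙ ∑[ i < m ] f (punchIn j i)     ≈⟨ ∙-cong ≈-refl (sum-cong-≋ (λ i → f≈0 _ (punchInᵢ≢i j i ∘ sym))) ⟩
    f j ∙ ∑[ i < m ] ε                   ≈⟨ ∙-cong ≈-refl (sum-replicate-zero m) ⟩
    f j ∙ ε                              ≈⟨ identityʳ _ ⟩
    f j                                  ∎

  ∑Tag-single : ∀ (h : Tag → Carrier) t → (∀ t′ → t ≢ t′ → h t′ ≈ ε) → ∑Tag h ≈ h t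
  ∑Tag-single h φ h≈0 = begin
    h φ ∙ h χ ∙ h ψ  ≈⟨ ∙-cong (∙-cong ≈-refl (h≈0 χ λ ())) (h≈0 ψ λ ()) ⟩
    h φ ∙ ε ∙ ε      ≈⟨ ≈-trans (identityʳ _) (identityʳ _) ⟩
    h φ              ∎
  ∑Tag-single h χ h≈0 = begin
    h φ ∙ h χ ∙ h ψ  ≈⟨ ∙-cong (∙-cong (h≈0 φ λ ()) ≈-refl) (h≈0 ψ λ ()) ⟩
    ε ∙ h χ ∙ ε      ≈⟨ ≈-trans (identityʳ _) (identityˡ _) ⟩
    h χ              ∎
  ∑Tag-single h ψ h≈0 = begin
    h φ ∙ h χ ∙ h ψ  ≈⟨ ∙-cong (∙-cong (h≈0 φ λ ()) (h≈0 χ λ ())) ≈-refl ⟩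
    ε ∙ ε ∙ h ψ      ≈⟨ ≈-trans (∙-cong (identityˡ _) ≈-refl) (identityˡ _) ⟩
    h ψ              ∎

  ∑Tag-zero : ∀ (h : Tag → Carrier) → (∀ t → h t ≈ ε) → ∑Tag h ≈ ε
  ∑Tag-zero h h≈0 = ≈-trans (∑Tag-single h φ (λ t′ _ → h≈0 t′)) (h≈0 φ)

  sum-zero : ∀ {m} (f : Fin m → Carrier) → (∀ i → f i ≈ ε) → sum f ≈ ε
  sum-zero {m} f f≈0 = ≈-trans (sum-cong-≋ {m} f≈0) (sum-replicate-zero m)

  ∑W-zero : ∀ {m} (g : W m → Carrier) → (∀ e → g e ≈ ε) → ∑W g ≈ ε
  ∑W-zero g g≈0 = sum-zero _ (λ w → ∑Tag-zero _ (λ t → g≈0 (w , t)))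

  ∑W-single : ∀ {m} (g : W m → Carrier) (a : W m) → (∀ e → a ≢ e → g e ≈ ε) → ∑W g ≈ g a
  ∑W-single g (u , t) g≈0 = ≈-trans (sum-single (λ w → ∑Tag (λ t′ → g (w , t′))) u off-u)
    (∑Tag-single _ t (λ t′ t≢t′ → g≈0 (u , t′) (t≢t′ ∘ cong proj₂)))
    where
    off-u : ∀ w → u ≢ w → ∑Tag (λ t′ → g (w , t′)) ≈ ε
    off-u w u≢w = ∑Tag-zero _ (λ t′ → g≈0 (w , t′) (u≢w ∘ cong proj₁))

  ∑Tag-comm-∑ : ∀ {k} (f : Tag → Fin k → Carrier) → ∑Tag (λ t → ∑[ j < k ] f t j) ≈ ∑[ j < k ] ∑Tag (λ t → f t j)
  ∑Tag-comm-∑ f = ≈-sym (≈-trans (∑-distrib-+ (λ j → f φ j ∙ f χ j) (f ψ)) (∙-cong (∑-distrib-+ (f φ) (f χ)) ≈-refl))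

  ∑W-comm-∑ : ∀ {m k} (f : W m → Fin k → Carrier) → ∑W (λ e → ∑[ j < k ] f e j) ≈ ∑[ j < k ] ∑W (λ e → f e j)
  ∑W-comm-∑ {m} f = ≈-trans (sum-cong-≋ {m} (λ w → ∑Tag-comm-∑ (λ t → f (w , t)))) (∑-comm (λ w j → ∑Tag (λ t → f (w , t) j)))

  ∑W-comm-∑Tag : ∀ {m} (f : W m → Tag → Carrier) → ∑W (λ e → ∑Tag (f e)) ≈ ∑Tag (λ t → ∑W (λ e → f e t))
  ∑W-comm-∑Tag f = ≈-trans (∑W-distrib (λ e → f e φ ∙ f e χ) (λ e → f e ψ)) (∙-cong (∑W-distrib (λ e → f e φ) (λ e → f e χ)) ≈-refl)

  ∑W-comm : ∀ {m k} (f : W m → W k → Carrier) → ∑W (λ e → ∑W (f e)) ≈ ∑W (λ e′ → ∑W (λ e → f e e′))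
  ∑W-comm {m} {k} f = ≈-trans (∑W-comm-∑ (λ e w′ → ∑Tag (λ t′ → f e (w′ , t′))))
    (sum-cong-≋ {k} (λ w′ → ∑W-comm-∑Tag (λ e t′ → f e (w′ , t′))))

𝔽₂ : AlmostCommutativeRing 0ℓ 0ℓ
𝔽₂ = fromCommutativeRing xor-∧-commutativeRing isZero
  where
  isZero : ∀ x → Maybe (false ≡ x)
  isZero false = just refl
  isZero true = nothing

module ℕW = SumOverW +-0-commutativeMonoid
module ℕ∑ = Algebra.Properties.Monoid.Sum +-0-monoid
open SumOverW (CommutativeRing.+-commutativeMonoid xor-∧-commutativeRing)
open Algebra.Properties.Semiring.Sum (CommutativeRing.semiring xor-∧-commutativeRing)
  using (sum; sum-syntax; sum-cong-≋; ∑-distrib-+; ∑-comm; *-distribˡ-sum)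

⌊⌋-true : ∀ {P : Set} (P? : Dec P) → ⌊ P? ⌋ ≡ true → P
⌊⌋-true (yes p) _ = p

⌊⌋-yes : ∀ {P : Set} (P? : Dec P) → P → ⌊ P? ⌋ ≡ true
⌊⌋-yes (yes _) _ = refl
⌊⌋-yes (no ¬p) p = contradiction p ¬p

⌊⌋-no : ∀ {P : Set} (P? : Dec P) → ¬ P → ⌊ P? ⌋ ≡ false
⌊⌋-no (yes p) ¬p = contradiction p ¬p
⌊⌋-no (no _) _ = refl

xor≡true : ∀ a b → a xor b ≡ true → a ≡ true ⊎ b ≡ true
xor≡true true _ _ = inj₁ refl
xor≡true false _ b≡true = inj₂ b≡true

∨≡true : ∀ a b → a ∨ b ≡ true → a ≡ true ⊎ b ≡ true
∨≡true true _ _ = inj₁ refl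
∨≡true false _ b≡true = inj₂ b≡true

∧≡true : ∀ a b → a ∧ b ≡ true → a ≡ true × b ≡ true
∧≡true true true _ = refl , refl

⇒-false : ∀ {a b} → (a ≡ true → b ≡ true) → b ≡ false → a ≡ false
⇒-false {true} a⇒b b≡false = trans (sym (a⇒b refl)) b≡false
⇒-false {false} _ _ = refl

xor≡false : ∀ a b → a xor b ≡ false → a ≡ b
xor≡false true true _ = refl
xor≡false false false _ = refl

_≟Tag_ : DecidableEquality Tag
φ ≟Tag φ = yes refl
χ ≟Tag χ = yes refl
ψ ≟Tag ψ = yes refl
φ ≟Tag χ = no λ ()
φ ≟Tag ψ = no λ ()
χ ≟Tag φ = no λ ()
χ ≟Tag ψ = no λ ()
ψ ≟Tag φ = no λ ()
ψ ≟Tag χ = no λ ()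

_≟W_ : ∀ {n} → DecidableEquality (W n)
_≟W_ = ≡-dec _≟_ _≟Tag_

｛_｝ : ∀ {n} → W n → SubsetW n
｛ a ｝ e = ⌊ a ≟W e ⌋

_∪_ _∩_ _∖_ _△_ : ∀ {n} → SubsetW n → SubsetW n → SubsetW n
(X ∪ Y) e = X e ∨ Y e
(X ∩ Y) e = X e ∧ Y e
(X ∖ Y) e = X e ∧ not (Y e)
(X △ Y) e = X e xor Y e

｛｝-≡ : ∀ {n} {a e : W n} → ｛ a ｝ e ≡ true → a ≡ e
｛｝-≡ {a = a} {e} = ⌊⌋-true (a ≟W e)

｛｝-refl : ∀ {n} (a : W n) → ｛ a ｝ a ≡ true
｛｝-refl a = ⌊⌋-yes (a ≟W a) refl

｛｝-≢ : ∀ {n} {a e : W n} → a ≢ e → ｛ a ｝ e ≡ false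
｛｝-≢ {a = a} {e} = ⌊⌋-no (a ≟W e)

｛｝-sym : ∀ {m} (a e : W m) → ｛ a ｝ e ≡ ｛ e ｝ a
｛｝-sym a e with a ≟W e
... | yes refl = sym (｛｝-refl a)
... | no a≢e = sym (｛｝-≢ (a≢e ∘ sym))

｛｝-tag : ∀ {n} (v : Fin n) t x → ｛ (v , t) ｝ (v , x) ≡ ⌊ t ≟Tag x ⌋
｛｝-tag v t x with t ≟Tag x
... | yes refl = ｛｝-refl (v , t)
... | no t≢x = ｛｝-≢ (t≢x ∘ ,-injectiveʳ)

⊆-false : ∀ {m} {T X : SubsetW m} → T ⊆W X → ∀ {a} → X a ≡ false → T a ≡ false
⊆-false T⊆X {a} = ⇒-false (T⊆X a)

｛｝⊆ : ∀ {m} {X : SubsetW m} {a} → X a ≡ true → ｛ a ｝ ⊆W X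
｛｝⊆ {X = X} Xa e a≡e = subst (λ x → X x ≡ true) (｛｝-≡ a≡e) Xa

∪-⊆ : ∀ {m} {X Y Z : SubsetW m} → X ⊆W Z → Y ⊆W Z → (X ∪ Y) ⊆W Z
∪-⊆ {X = X} X⊆Z Y⊆Z e X∪Y with ∨≡true (X e) _ X∪Y
... | inj₁ Xe = X⊆Z e Xe
... | inj₂ Ye = Y⊆Z e Ye

⊆-∪ˡ : ∀ {m} {X Y : SubsetW m} → X ⊆W (X ∪ Y)
⊆-∪ˡ e Xe rewrite Xe = refl

⊆-∪ʳ : ∀ {m} {X Y : SubsetW m} → Y ⊆W (X ∪ Y)
⊆-∪ʳ {X = X} e Ye rewrite Ye = ∨-zeroʳ (X e)

∖-⊆ : ∀ {m} {X Y : SubsetW m} → (X ∖ Y) ⊆W X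
∖-⊆ {X = X} e X∖Y = proj₁ (∧≡true (X e) _ X∖Y)

∖-｛｝-self : ∀ {m} (X : SubsetW m) a → (X ∖ ｛ a ｝) a ≡ false
∖-｛｝-self X a = trans (cong (λ b → X a ∧ not b) (｛｝-refl a)) (∧-zeroʳ (X a))

∖-｛｝-≢ : ∀ {m} {X : SubsetW m} {a e} → (X ∖ ｛ a ｝) e ≡ true → a ≢ e
∖-｛｝-≢ {X = X} {a} X∖a refl = contradiction (trans (sym X∖a) (∖-｛｝-self X a)) λ ()

∪-｛｝-elim : ∀ {m} {X : SubsetW m} {a e} → (X ∪ ｛ a ｝) e ≡ true → a ≢ e → X e ≡ true
∪-｛｝-elim {X = X} {a} {e} X∪a a≢e with ∨≡true (X e) _ X∪a
... | inj₁ Xe = Xe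
... | inj₂ a≡e = contradiction (｛｝-≡ a≡e) a≢e

⊆-∪-｛｝-without : ∀ {m} {T X : SubsetW m} {a} → T ⊆W (X ∪ ｛ a ｝) → T a ≡ false → T ⊆W X
⊆-∪-｛｝-without {T = T} {X} {a} T⊆X∪a Ta e Te with a ≟W e
... | yes refl = contradiction (trans (sym Te) Ta) λ ()
... | no a≢e = ∪-｛｝-elim {X = X} (T⊆X∪a e Te) a≢e

⊆-∪-｛｝-with : ∀ {m} {T X : SubsetW m} {a} → T ⊆W (X ∪ ｛ a ｝) → T a ≡ true → (T △ ｛ a ｝) ⊆W X
⊆-∪-｛｝-with {T = T} {X} {a} T⊆X∪a Ta e T△a with a ≟W e
... | yes refl = contradiction (trans (sym T△a) (cong (_xor true) Ta)) λ ()
... | no a≢e = ∪-｛｝-elim {X = X} (T⊆X∪a e (trans (sym (xor-identityʳ (T e))) T△a)) a≢e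

∧-vanishes : ∀ {m} {T X : SubsetW m} (h : W m → Bool) → T ⊆W X → (∀ a → X a ≡ true → h a ≡ false) → ∀ e → T e ∧ h e ≡ false
∧-vanishes {T = T} h T⊆X h≡false e with T e in Te
... | true = h≡false e (T⊆X e Te)
... | false = refl

insertW-≗ : ∀ {n} (X : SubsetW n) a e → insertW X a e ≡ (X ∪ ｛ a ｝) e
insertW-≗ X (w , t) (w′ , t′) with w ≟ w′ | t | t′
... | no _     | _ | _ = sym (∨-identityʳ _)
... | yes refl | φ | φ = sym (∨-zeroʳ _)
... | yes refl | χ | χ = sym (∨-zeroʳ _)
... | yes refl | ψ | ψ = sym (∨-zeroʳ _)
... | yes refl | φ | χ = sym (∨-identityʳ _)
... | yes refl | φ | ψ = sym (∨-identityʳ _)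
... | yes refl | χ | φ = sym (∨-identityʳ _)
... | yes refl | χ | ψ = sym (∨-identityʳ _)
... | yes refl | ψ | φ = sym (∨-identityʳ _)
... | yes refl | ψ | χ = sym (∨-identityʳ _)

Subtransversal-∪-｛｝ : ∀ {n} {S : SubsetW n} → Subtransversal S → ∀ {v} → (∀ t → S (v , t) ≡ false) →
  ∀ t → Subtransversal (S ∪ ｛ (v , t) ｝)
Subtransversal-∪-｛｝ {S = S} st {v} Sv≡0 t w t₁ t₂ in₁ in₂ with ∨≡true (S (w , t₁)) _ in₁ | ∨≡true (S (w , t₂)) _ in₂
... | inj₁ S₁ | inj₁ S₂ = st w t₁ t₂ S₁ S₂
... | inj₂ v₁ | inj₂ v₂ = trans (sym (,-injectiveʳ (｛｝-≡ v₁))) (,-injectiveʳ (｛｝-≡ v₂))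
... | inj₁ S₁ | inj₂ v₂ = contradiction (trans (sym S₁) (subst (λ u → S (u , t₁) ≡ false) (,-injectiveˡ (｛｝-≡ v₂)) (Sv≡0 t₁))) λ ()
... | inj₂ v₁ | inj₁ S₂ = contradiction (trans (sym S₂) (subst (λ u → S (u , t₂) ≡ false) (,-injectiveˡ (｛｝-≡ v₁)) (Sv≡0 t₂))) λ ()

any?Tag : ∀ {P : Tag → Set} → (∀ t → Dec (P t)) → Dec (Σ Tag P)
any?Tag P? with P? φ | P? χ | P? ψ
... | yes p | _     | _     = yes (φ , p)
... | no _  | yes p | _     = yes (χ , p)
... | no _  | no _  | yes p = yes (ψ , p)
... | no ¬a | no ¬b | no ¬c = no λ { (φ , p) → ¬a p ; (χ , p) → ¬b p ; (ψ , p) → ¬c p }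

all?Tag : ∀ {P : Tag → Set} → (∀ t → Dec (P t)) → Dec (∀ t → P t)
all?Tag P? = map′ (λ (a , b , c) → λ { φ → a ; χ → b ; ψ → c }) (λ h → h φ , h χ , h ψ)
  (P? φ ×-dec (P? χ ×-dec P? ψ))

any?W : ∀ {m} {P : W m → Set} → (∀ e → Dec (P e)) → Dec (Σ (W m) P)
any?W P? = map′ (λ (w , t , p) → (w , t) , p) (λ ((w , t) , p) → w , t , p)
  (any? (λ w → any?Tag (λ t → P? (w , t))))

all?W : ∀ {m} {P : W m → Set} → (∀ e → Dec (P e)) → Dec (∀ e → P e)
all?W P? = map′ (λ h (w , t) → h w t) (λ h w t → h (w , t))
  (all? (λ w → all?Tag (λ t → P? (w , t))))

fromSubsets : ∀ {m} → Subset m → Subset m → Subset m → SubsetW m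
fromSubsets a b c (w , φ) = lookup a w
fromSubsets a b c (w , χ) = lookup b w
fromSubsets a b c (w , ψ) = lookup c w

fromSubsets-tabulate : ∀ {m} (X : SubsetW m) e →
  fromSubsets (tabulate (λ w → X (w , φ))) (tabulate (λ w → X (w , χ))) (tabulate (λ w → X (w , ψ))) e ≡ X e
fromSubsets-tabulate X (w , φ) = lookup∘tabulate _ w
fromSubsets-tabulate X (w , χ) = lookup∘tabulate _ w
fromSubsets-tabulate X (w , ψ) = lookup∘tabulate _ w

any?SubsetW : ∀ {m} {P : SubsetW m → Set} → (∀ {X Y} → (∀ e → X e ≡ Y e) → P X → P Y) →
  (∀ X → Dec (P X)) → Dec (Σ (SubsetW m) P)
any?SubsetW {P = P} resp P? = map′ (λ (a , b , c , p) → fromSubsets a b c , p)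
  (λ (X , p) → _ , _ , _ , resp (sym ∘ fromSubsets-tabulate X) p)
  (anySubset? λ a → anySubset? λ b → anySubset? λ c → P? (fromSubsets a b c))

Subtransversal-single-tag : ∀ {n} {R : SubsetW n} → Subtransversal R → ∀ u →
  Σ Tag (λ t → ∀ t′ → t ≢ t′ → R (u , t′) ≡ false)
Subtransversal-single-tag {R = R} st u with any?Tag (λ t → R (u , t) Bool.≟ true)
... | yes (t , Rt) = t , λ t′ t≢t′ → ¬-not λ Rt′ → t≢t′ (st u t t′ Rt Rt′)
... | no none = φ , λ t′ _ → ¬-not λ Rt′ → none (t′ , Rt′)

∑W-｛｝ : ∀ {n} (a : W n) (h : W n → Bool) → ∑W (λ e → ｛ a ｝ e ∧ h e) ≡ h a
∑W-｛｝ a h = trans (∑W-single _ a (λ e a≢e → cong (_∧ h e) (｛｝-≢ a≢e))) (cong (_∧ h a) (｛｝-refl a))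

∑W-true : ∀ {m} (g : W m → Bool) → ∑W g ≡ true → Σ (W m) (λ e → g e ≡ true)
∑W-true g ∑g≡true with any?W (λ e → g e Bool.≟ true)
... | yes p = p
... | no none = contradiction (trans (sym ∑g≡true) (∑W-zero g (λ e → ¬-not (λ ge → none (e , ge))))) λ ()

∑W-∧ˡ : ∀ {m} b (g : W m → Bool) → b ∧ ∑W g ≡ ∑W (λ e → b ∧ g e)
∑W-∧ˡ {m} b g = trans (*-distribˡ-sum b (λ w → ∑Tag (λ t → g (w , t))))
  (sum-cong-≋ {m} (λ w → trans (∧-distribˡ-xor b _ _) (cong (_xor (b ∧ g (w , ψ))) (∧-distribˡ-xor b _ _))))

∑W-∧ʳ : ∀ {m} b (g : W m → Bool) → ∑W g ∧ b ≡ ∑W (λ e → g e ∧ b)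
∑W-∧ʳ b g = trans (∧-comm _ b) (trans (∑W-∧ˡ b g) (∑W-cong (λ e → ∧-comm b (g e))))

∑W-△-｛｝ : ∀ {m} (L : SubsetW m) (T : W m → SubsetW m) s₀ → (∀ s → L s ≡ true → T s s₀ ≡ false) →
  ∑W (λ s → L s ∧ (T s △ ｛ s ｝) s₀) ≡ L s₀
∑W-△-｛｝ L T s₀ T∌s₀ = begin
  ∑W (λ s → L s ∧ (T s s₀ xor ｛ s ｝ s₀))                       ≡⟨ ∑W-cong (λ s → ∧-distribˡ-xor (L s) (T s s₀) (｛ s ｝ s₀)) ⟩
  ∑W (λ s → (L s ∧ T s s₀) xor (L s ∧ ｛ s ｝ s₀))               ≡⟨ ∑W-distrib (λ s → L s ∧ T s s₀) (λ s → L s ∧ ｛ s ｝ s₀) ⟩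
  ∑W (λ s → L s ∧ T s s₀) xor ∑W (λ s → L s ∧ ｛ s ｝ s₀)        ≡⟨ cong₂ _xor_ T-part ｛｝-part ⟩
  L s₀                                                        ∎
  where
  open ≡-Reasoning
  T-part : ∑W (λ s → L s ∧ T s s₀) ≡ false
  T-part = ∑W-zero _ (∧-vanishes (λ s → T s s₀) (λ _ → id) T∌s₀)
  ｛｝-part : ∑W (λ s → L s ∧ ｛ s ｝ s₀) ≡ L s₀
  ｛｝-part = trans (∑W-cong (λ s → trans (cong (L s ∧_) (｛｝-sym s s₀)) (∧-comm (L s) _))) (∑W-｛｝ s₀ L)

sumFinN-sum : ∀ n (f : Fin n → ℕ) → sumFinN n f ≡ ℕ∑.sum f
sumFinN-sum zero f = refl
sumFinN-sum (suc n) f = cong (f zero +_) (sumFinN-sum n (f ∘ suc))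

size-∑W : ∀ {n} (X : SubsetW n) → size X ≡ ℕW.∑W (λ e → b2n (X e))
size-∑W {n} X = sumFinN-sum n _

size-≗ : ∀ {n} {X Y : SubsetW n} → (∀ e → X e ≡ Y e) → size X ≡ size Y
size-≗ {X = X} {Y} X≗Y = trans (size-∑W X) (trans (ℕW.∑W-cong (cong b2n ∘ X≗Y)) (sym (size-∑W Y)))

b2n-∩-∖ : ∀ x y → b2n x ≡ b2n (x ∧ y) + b2n (x ∧ not y)
b2n-∩-∖ true true = refl
b2n-∩-∖ true false = refl
b2n-∩-∖ false y = refl

b2n≤1 : ∀ x → b2n x ≤ 1
b2n≤1 true = ≤-refl
b2n≤1 false = z≤n

size-∩-∖ : ∀ {n} (X Y : SubsetW n) → size X ≡ size (X ∩ Y) + size (X ∖ Y)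
size-∩-∖ X Y = begin
  size X                                                        ≡⟨ size-∑W X ⟩
  ℕW.∑W (λ e → b2n (X e))                                       ≡⟨ ℕW.∑W-cong (λ e → b2n-∩-∖ (X e) (Y e)) ⟩
  ℕW.∑W (λ e → b2n ((X ∩ Y) e) + b2n ((X ∖ Y) e))               ≡⟨ ℕW.∑W-distrib (λ e → b2n ((X ∩ Y) e)) (λ e → b2n ((X ∖ Y) e)) ⟩
  ℕW.∑W (λ e → b2n ((X ∩ Y) e)) + ℕW.∑W (λ e → b2n ((X ∖ Y) e)) ≡⟨ sym (cong₂ _+_ (size-∑W (X ∩ Y)) (size-∑W (X ∖ Y))) ⟩
  size (X ∩ Y) + size (X ∖ Y)                                   ∎
  where open ≡-Reasoning

size-∩-｛｝ : ∀ {n} (X : SubsetW n) (a : W n) → size (X ∩ ｛ a ｝) ≡ b2n (X a)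
size-∩-｛｝ X a = trans (size-∑W (X ∩ ｛ a ｝))
  (trans (ℕW.∑W-single _ a (λ e a≢e → cong b2n (trans (cong (X e ∧_) (｛｝-≢ a≢e)) (∧-zeroʳ (X e)))))
         (cong b2n (trans (cong (X a ∧_) (｛｝-refl a)) (∧-identityʳ (X a)))))

∪-∖-｛｝ : ∀ {n} (X : SubsetW n) (a : W n) → X a ≡ false → ∀ e → ((X ∪ ｛ a ｝) ∖ ｛ a ｝) e ≡ X e
∪-∖-｛｝ X a Xa≡false e with a ≟W e
... | yes refl = trans (∧-zeroʳ _) (sym Xa≡false)
... | no _ = trans (∧-identityʳ _) (∨-identityʳ (X e))

size-∪-｛｝ : ∀ {n} (X : SubsetW n) (a : W n) → X a ≡ false → size (X ∪ ｛ a ｝) ≡ suc (size X)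
size-∪-｛｝ X a Xa≡false = begin
  size (X ∪ ｛ a ｝)                                              ≡⟨ size-∩-∖ (X ∪ ｛ a ｝) ｛ a ｝ ⟩
  size ((X ∪ ｛ a ｝) ∩ ｛ a ｝) + size ((X ∪ ｛ a ｝) ∖ ｛ a ｝)    ≡⟨ cong₂ _+_ (size-∩-｛｝ (X ∪ ｛ a ｝) a) (size-≗ (∪-∖-｛｝ X a Xa≡false)) ⟩
  b2n (X a ∨ ｛ a ｝ a) + size X                                  ≡⟨ cong (λ y → b2n (X a ∨ y) + size X) (｛｝-refl a) ⟩
  b2n (X a ∨ true) + size X                                     ≡⟨ cong (λ y → b2n y + size X) (∨-zeroʳ (X a)) ⟩
  suc (size X)                                                  ∎
  where open ≡-Reasoning

size-≤-∖-｛｝ : ∀ {n} (X : SubsetW n) (a : W n) → size X ≤ suc (size (X ∖ ｛ a ｝))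
size-≤-∖-｛｝ X a = begin
  size X                                  ≡⟨ size-∩-∖ X ｛ a ｝ ⟩
  size (X ∩ ｛ a ｝) + size (X ∖ ｛ a ｝)    ≡⟨ cong (_+ size (X ∖ ｛ a ｝)) (size-∩-｛｝ X a) ⟩
  b2n (X a) + size (X ∖ ｛ a ｝)            ≤⟨ +-monoˡ-≤ _ (b2n≤1 (X a)) ⟩
  suc (size (X ∖ ｛ a ｝))                  ∎
  where open ≤-Reasoning

size-∅ : ∀ {m} (X : SubsetW m) → (∀ e → X e ≡ false) → size X ≡ 0
size-∅ X X≡false = trans (size-∑W X) (ℕW.∑W-zero _ (λ e → cong b2n (X≡false e)))

-- Linear algebra over GF(2)

_·_ : ∀ {n} → Vec2 n → Vec2 n → Bool
_·_ {n} x y = ∑[ i < n ] (x i ∧ y i)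

·-comm : ∀ {n} (x y : Vec2 n) → x · y ≡ y · x
·-comm {n} x y = sum-cong-≋ {n} (λ i → ∧-comm (x i) (y i))

·-xor-scale : ∀ {n} (x y z : Vec2 n) c → x · (λ i → y i xor (c ∧ z i)) ≡ (x · y) xor (c ∧ (x · z))
·-xor-scale {n} x y z c = begin
  ∑[ i < n ] (x i ∧ (y i xor (c ∧ z i)))                     ≡⟨ sum-cong-≋ {n} (λ i → distrib (x i) (y i) (z i) c) ⟩
  ∑[ i < n ] ((x i ∧ y i) xor (c ∧ (x i ∧ z i)))             ≡⟨ ∑-distrib-+ (λ i → x i ∧ y i) (λ i → c ∧ (x i ∧ z i)) ⟩
  (x · y) xor ∑[ i < n ] (c ∧ (x i ∧ z i))                   ≡⟨ cong ((x · y) xor_) (sym (*-distribˡ-sum c (λ i → x i ∧ z i))) ⟩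
  (x · y) xor (c ∧ (x · z))                                  ∎
  where
  open ≡-Reasoning
  distrib : ∀ x y z c → x ∧ (y xor (c ∧ z)) ≡ (x ∧ y) xor (c ∧ (x ∧ z))
  distrib = solve-∀ 𝔽₂

·-zeroʳ : ∀ {n} (x : Vec2 n) {y : Vec2 n} → (∀ i → y i ≡ false) → x · y ≡ false
·-zeroʳ x y≡0 = sum-zero _ (λ i → trans (cong (x i ∧_) (y≡0 i)) (∧-zeroʳ (x i)))

lincomb : ∀ {m n} → (W m → Vec2 n) → SubsetW m → Vec2 n
lincomb f T i = ∑W (λ e → T e ∧ f e i)

IndependentOn : ∀ {m n} → (W m → Vec2 n) → SubsetW m → Set
IndependentOn f X = ∀ T → T ⊆W X → (∀ i → lincomb f T i ≡ false) → ∀ e → T e ≡ false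

OrthogonalOn : ∀ {m n} → (f g : W m → Vec2 n) → SubsetW m → SubsetW m → Set
OrthogonalOn f g X Z = ∀ a b → X a ≡ true → Z b ≡ true → f a · g b ≡ false

InSpan : ∀ {m n} → (W m → Vec2 n) → SubsetW m → Vec2 n → Set
InSpan {m} f X x = Σ (SubsetW m) (λ T → T ⊆W X × (∀ i → lincomb f T i ≡ x i))

lincomb-· : ∀ {m n} (f : W m → Vec2 n) T y → lincomb f T · y ≡ ∑W (λ e → T e ∧ (f e · y))
lincomb-· {m} {n} f T y = begin
  ∑[ i < n ] (∑W (λ e → T e ∧ f e i) ∧ y i)   ≡⟨ sum-cong-≋ {n} (λ i → ∑W-∧ʳ (y i) (λ e → T e ∧ f e i)) ⟩
  ∑[ i < n ] ∑W (λ e → (T e ∧ f e i) ∧ y i)   ≡⟨ sym (∑W-comm-∑ (λ e i → (T e ∧ f e i) ∧ y i)) ⟩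
  ∑W (λ e → ∑[ i < n ] ((T e ∧ f e i) ∧ y i)) ≡⟨ ∑W-cong (λ e → sum-cong-≋ {n} (λ i → ∧-assoc (T e) (f e i) (y i))) ⟩
  ∑W (λ e → ∑[ i < n ] (T e ∧ (f e i ∧ y i))) ≡⟨ ∑W-cong (λ e → sym (*-distribˡ-sum (T e) (λ i → f e i ∧ y i))) ⟩
  ∑W (λ e → T e ∧ (f e · y))                  ∎
  where open ≡-Reasoning

lincomb-△ : ∀ {m n} (f : W m → Vec2 n) T U i → lincomb f (T △ U) i ≡ lincomb f T i xor lincomb f U i
lincomb-△ f T U i = trans (∑W-cong (λ e → ∧-distribʳ-xor (f e i) (T e) (U e))) (∑W-distrib (λ e → T e ∧ f e i) (λ e → U e ∧ f e i))

lincomb-scale : ∀ {m n} (f : W m → Vec2 n) c T i → lincomb f (λ e → c ∧ T e) i ≡ c ∧ lincomb f T i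
lincomb-scale f c T i = trans (∑W-cong (λ e → ∧-assoc c (T e) (f e i))) (sym (∑W-∧ˡ c (λ e → T e ∧ f e i)))

lincomb-｛｝ : ∀ {m n} (f : W m → Vec2 n) a i → lincomb f ｛ a ｝ i ≡ f a i
lincomb-｛｝ f a i = ∑W-｛｝ a (λ e → f e i)

lincomb-△-｛｝ : ∀ {m n} (f : W m → Vec2 n) T a i → lincomb f (T △ ｛ a ｝) i ≡ lincomb f T i xor f a i
lincomb-△-｛｝ f T a i = trans (lincomb-△ f T ｛ a ｝ i) (cong (lincomb f T i xor_) (lincomb-｛｝ f a i))

lincomb-∑W : ∀ {m n} (f : W m → Vec2 n) (L : SubsetW m) (D : W m → SubsetW m) i →
  lincomb f (λ e → ∑W (λ s → L s ∧ D s e)) i ≡ ∑W (λ s → L s ∧ lincomb f (D s) i)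
lincomb-∑W f L D i = begin
  ∑W (λ e → ∑W (λ s → L s ∧ D s e) ∧ f e i)     ≡⟨ ∑W-cong (λ e → ∑W-∧ʳ (f e i) (λ s → L s ∧ D s e)) ⟩
  ∑W (λ e → ∑W (λ s → (L s ∧ D s e) ∧ f e i))   ≡⟨ ∑W-comm (λ e s → (L s ∧ D s e) ∧ f e i) ⟩
  ∑W (λ s → ∑W (λ e → (L s ∧ D s e) ∧ f e i))   ≡⟨ ∑W-cong (λ s → ∑W-cong (λ e → ∧-assoc (L s) (D s e) (f e i))) ⟩
  ∑W (λ s → ∑W (λ e → L s ∧ (D s e ∧ f e i)))   ≡⟨ ∑W-cong (λ s → sym (∑W-∧ˡ (L s) (λ e → D s e ∧ f e i))) ⟩
  ∑W (λ s → L s ∧ lincomb f (D s) i)            ∎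
  where open ≡-Reasoning

span⇒circuit : ∀ {m n} (f : W m → Vec2 n) T a → (∀ i → lincomb f T i ≡ f a i) → ∀ i → lincomb f (T △ ｛ a ｝) i ≡ false
span⇒circuit f T a T-spans i = trans (lincomb-△-｛｝ f T a i) (trans (cong (_xor f a i) (T-spans i)) (xor-same (f a i)))

IndependentOn-⊆ : ∀ {m n} {f : W m → Vec2 n} {X X′} → X ⊆W X′ → IndependentOn f X′ → IndependentOn f X
IndependentOn-⊆ X⊆X′ indep T T⊆X = indep T (λ e → X⊆X′ e ∘ T⊆X e)

InSpan-⊆ : ∀ {m n} {f : W m → Vec2 n} {X X′ x} → X ⊆W X′ → InSpan f X x → InSpan f X′ x
InSpan-⊆ X⊆X′ (T , T⊆X , T-spans) = T , (λ e → X⊆X′ e ∘ T⊆X e) , T-spans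

InSpan-∪-｛｝ : ∀ {m n} (f : W m → Vec2 n) X a x → InSpan f (X ∪ ｛ a ｝) x → InSpan f X x ⊎ InSpan f X (λ i → x i xor f a i)
InSpan-∪-｛｝ f X a x (T , T⊆X∪a , T-spans) with T a in Ta
... | false = inj₁ (T , ⊆-∪-｛｝-without T⊆X∪a Ta , T-spans)
... | true = inj₂ (T △ ｛ a ｝ , ⊆-∪-｛｝-with T⊆X∪a Ta , λ i → trans (lincomb-△-｛｝ f T a i) (cong (_xor f a i) (T-spans i)))

independent-∪-｛｝ : ∀ {m n} (f : W m → Vec2 n) X a → IndependentOn f X → ¬ InSpan f X (f a) → IndependentOn f (X ∪ ｛ a ｝)
independent-∪-｛｝ f X a indep a∉span T T⊆X∪a T≡0 with T a in Ta
... | true = contradiction (T △ ｛ a ｝ , ⊆-∪-｛｝-with T⊆X∪a Ta , λ i → trans (lincomb-△-｛｝ f T a i) (cong (_xor f a i) (T≡0 i))) a∉span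
... | false = indep T (⊆-∪-｛｝-without T⊆X∪a Ta) T≡0

InSpan? : ∀ {m n} (f : W m → Vec2 n) X x → Dec (InSpan f X x)
InSpan? f X x = any?SubsetW resp (λ T → all?W (λ e → (T e Bool.≟ true) →-dec (X e Bool.≟ true)) ×-dec all? (λ i → lincomb f T i Bool.≟ x i))
  where
  resp : ∀ {T U} → (∀ e → T e ≡ U e) → (T ⊆W X × (∀ i → lincomb f T i ≡ x i)) → (U ⊆W X × (∀ i → lincomb f U i ≡ x i))
  resp T≗U (T⊆X , T-spans) = (λ e Ue → T⊆X e (trans (T≗U e) Ue)) , (λ i → trans (∑W-cong (λ e → cong (_∧ f e i) (sym (T≗U e)))) (T-spans i))

independent-tail : ∀ {m n} (f : W m → Vec2 (suc n)) X → IndependentOn f X →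
  (∀ T → T ⊆W X → (∀ i → lincomb f T (suc i) ≡ false) → lincomb f T zero ≡ false) →
  IndependentOn (λ e → tail (f e)) X
independent-tail f X indep head≡0 T T⊆X tail≡0 = indep T T⊆X λ
  { zero → head≡0 T T⊆X tail≡0
  ; (suc i) → tail≡0 i }

independent-tail-of-head≡0 : ∀ {m n} (f : W m → Vec2 (suc n)) X → IndependentOn f X →
  (∀ a → X a ≡ true → f a zero ≡ false) → IndependentOn (λ e → tail (f e)) X
independent-tail-of-head≡0 f X indep head≡0 = independent-tail f X indep
  λ T T⊆X _ → ∑W-zero _ (∧-vanishes (λ e → f e zero) T⊆X head≡0)

module Pivot {m n} (f g : W m → Vec2 (suc n)) (X Z : SubsetW m)
  (indepX : IndependentOn f X) (indepZ : IndependentOn g Z) (orth : OrthogonalOn f g X Z)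
  (j : W m) (Zj : Z j ≡ true) (gj₀ : g j zero ≡ true) where

  -- Gaussian elimination of the first coordinate with the pivot g j: g′ e = tail (g e + (g e)₀ g j).
  g′ : W m → Vec2 n
  g′ e i = g e (suc i) xor (g e zero ∧ g j (suc i))

  Z′ : SubsetW m
  Z′ = Z ∖ ｛ j ｝

  -- Every combination of the f a is orthogonal to g j, so its first entry is determined by the others.
  indepX′ : IndependentOn (λ e → tail (f e)) X
  indepX′ = independent-tail f X indepX λ T T⊆X tail≡0 → begin
    lincomb f T zero                                      ≡⟨ sym (∧-identityʳ _) ⟩
    lincomb f T zero ∧ true                               ≡⟨ sym (xor-identityʳ _) ⟩
    (lincomb f T zero ∧ true) xor false                   ≡⟨ cong₂ (λ x y → (lincomb f T zero ∧ x) xor y) (sym gj₀)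
                                                               (sym (sum-zero _ (λ i → cong (_∧ g j (suc i)) (tail≡0 i)))) ⟩
    lincomb f T · g j                                     ≡⟨ lincomb-· f T (g j) ⟩
    ∑W (λ e → T e ∧ (f e · g j))                          ≡⟨ ∑W-zero _ (∧-vanishes (λ e → f e · g j) T⊆X (λ a Xa → orth a j Xa Zj)) ⟩
    false                                                 ∎
    where open ≡-Reasoning

  -- A dependency T among the g′ on Z′ lifts to the dependency T △ c｛j｝ among the g on Z.
  indepZ′ : IndependentOn g′ Z′
  indepZ′ T T⊆Z′ lincomb≡0 e with j ≟W e
  ... | yes refl = ⊆-false T⊆Z′ (∖-｛｝-self Z j)
  ... | no j≢e = begin
    T e                        ≡⟨ sym (xor-identityʳ (T e)) ⟩
    T e xor false              ≡⟨ cong (T e xor_) (sym (trans (cong (c ∧_) (｛｝-≢ j≢e)) (∧-zeroʳ c))) ⟩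
    μ e                        ≡⟨ indepZ μ μ⊆Z μ-dependency e ⟩
    false                      ∎
    where
    open ≡-Reasoning
    c : Bool
    c = lincomb g T zero
    μ : SubsetW m
    μ = T △ (λ e → c ∧ ｛ j ｝ e)
    lincomb-μ : ∀ i → lincomb g μ i ≡ lincomb g T i xor (c ∧ g j i)
    lincomb-μ i = trans (lincomb-△ g T (λ e → c ∧ ｛ j ｝ e) i)
      (cong (lincomb g T i xor_) (trans (lincomb-scale g c ｛ j ｝ i) (cong (c ∧_) (lincomb-｛｝ g j i))))
    lincomb-g′ : ∀ i → lincomb g′ T i ≡ lincomb g T (suc i) xor (c ∧ g j (suc i))
    lincomb-g′ i = trans (∑W-cong (λ e → ∧-distribˡ-xor (T e) (g e (suc i)) (g e zero ∧ g j (suc i))))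
      (trans (∑W-distrib (λ e → T e ∧ g e (suc i)) (λ e → T e ∧ (g e zero ∧ g j (suc i))))
        (cong (lincomb g T (suc i) xor_) (trans (∑W-cong (λ e → sym (∧-assoc (T e) (g e zero) (g j (suc i)))))
          (sym (∑W-∧ʳ (g j (suc i)) (λ e → T e ∧ g e zero))))))
    μ-dependency : ∀ i → lincomb g μ i ≡ false
    μ-dependency zero = trans (lincomb-μ zero)
      (trans (cong (λ x → c xor (c ∧ x)) gj₀) (trans (cong (c xor_) (∧-identityʳ c)) (xor-same c)))
    μ-dependency (suc i) = trans (lincomb-μ (suc i)) (trans (sym (lincomb-g′ i)) (lincomb≡0 i))
    μ⊆Z : μ ⊆W Z
    μ⊆Z e μe with xor≡true (T e) _ μe
    ... | inj₁ Te = proj₁ (∧≡true _ _ (T⊆Z′ e Te))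
    ... | inj₂ cje = subst (λ x → Z x ≡ true) (｛｝-≡ (proj₂ (∧≡true c _ cje))) Zj

  orth′ : OrthogonalOn (λ e → tail (f e)) g′ X Z′
  orth′ a b Xa Z′b = begin
    tail (f a) · g′ b                                                      ≡⟨ ·-xor-scale (tail (f a)) (tail (g b)) (tail (g j)) (g b zero) ⟩
    (tail (f a) · tail (g b)) xor (g b zero ∧ (tail (f a) · tail (g j)))   ≡⟨ cong₂ (λ x y → x xor (g b zero ∧ y)) (tail-dot b Zb) (tail-dot j Zj) ⟩
    (f a zero ∧ g b zero) xor (g b zero ∧ (f a zero ∧ g j zero))           ≡⟨ cong (λ x → (f a zero ∧ g b zero) xor (g b zero ∧ (f a zero ∧ x))) gj₀ ⟩
    (f a zero ∧ g b zero) xor (g b zero ∧ (f a zero ∧ true))               ≡⟨ cancel (f a zero) (g b zero) ⟩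
    false                                                                  ∎
    where
    open ≡-Reasoning
    Zb : Z b ≡ true
    Zb = proj₁ (∧≡true _ _ Z′b)
    tail-dot : ∀ b → Z b ≡ true → tail (f a) · tail (g b) ≡ f a zero ∧ g b zero
    tail-dot b Zb = sym (xor≡false _ _ (orth a b Xa Zb))
    cancel : ∀ x y → (x ∧ y) xor (y ∧ (x ∧ true)) ≡ false
    cancel x y = trans (cong (λ z → (x ∧ y) xor z) (trans (cong (y ∧_) (∧-identityʳ x)) (∧-comm y x))) (xor-same (x ∧ y))

DimensionBound : ℕ → Set
DimensionBound n = ∀ {m} (f g : W m → Vec2 n) X Z →
  IndependentOn f X → IndependentOn g Z → OrthogonalOn f g X Z → size X + size Z ≤ n

pivot-bound : ∀ {n} → DimensionBound n → ∀ {m} (f g : W m → Vec2 (suc n)) X Z →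
  IndependentOn f X → IndependentOn g Z → OrthogonalOn f g X Z →
  ∀ j → Z j ≡ true → g j zero ≡ true → size X + size Z ≤ suc n
pivot-bound {n} bound f g X Z indepX indepZ orth j Zj gj₀ = begin
  size X + size Z               ≤⟨ +-monoʳ-≤ (size X) (size-≤-∖-｛｝ Z j) ⟩
  size X + suc (size Z′)        ≡⟨ +-suc (size X) (size Z′) ⟩
  suc (size X + size Z′)        ≤⟨ s≤s (bound _ g′ X Z′ indepX′ indepZ′ orth′) ⟩
  suc n                         ∎
  where
  open Pivot f g X Z indepX indepZ orth j Zj gj₀
  open ≤-Reasoning

dimension-bound : ∀ n → DimensionBound n
dimension-bound zero f g X Z indepX indepZ _ = ≤-reflexive (cong₂ _+_
  (size-∅ X (indepX X (λ _ Xe → Xe) λ ())) (size-∅ Z (indepZ Z (λ _ Ze → Ze) λ ())))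
dimension-bound (suc n) f g X Z indepX indepZ orth
  with any?W (λ b → (Z b Bool.≟ true) ×-dec (g b zero Bool.≟ true))
... | yes (j , Zj , gj₀) = pivot-bound (dimension-bound n) f g X Z indepX indepZ orth j Zj gj₀
... | no noPivotZ with any?W (λ a → (X a Bool.≟ true) ×-dec (f a zero Bool.≟ true))
...   | yes (j , Xj , fj₀) = subst (_≤ suc n) (+-comm (size Z) (size X))
          (pivot-bound (dimension-bound n) g f Z X indepZ indepX (λ a b Za Xb → trans (·-comm (g a) (f b)) (orth b a Xb Za)) j Xj fj₀)
...   | no noPivotX = m≤n⇒m≤1+n (dimension-bound n (λ e → tail (f e)) (λ e → tail (g e)) X Z
          (independent-tail-of-head≡0 f X indepX (head≡0 X f noPivotX)) (independent-tail-of-head≡0 g Z indepZ (head≡0 Z g noPivotZ))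
          λ a b Xa Zb → trans (cong (λ x → (x ∧ g b zero) xor (tail (f a) · tail (g b))) (sym (head≡0 X f noPivotX a Xa))) (orth a b Xa Zb))
  where
  head≡0 : ∀ (Y : SubsetW _) (h : W _ → Vec2 (suc n)) → ¬ Σ _ (λ a → Y a ≡ true × h a zero ≡ true) → ∀ a → Y a ≡ true → h a zero ≡ false
  head≡0 _ _ none a Ya = ¬-not λ ha → none (a , Ya , ha)

-- The matroid M(IAS(G))

-- Since the columns of u_φ, u_χ, u_ψ are e_u, A e_u and e_u + A e_u, the columns of D sum to p(D) + A q(D),
-- where p and q read off the coefficients of e_u and A e_u at each vertex u.
p q : (Tag → Bool) → Bool
p d = d φ xor d ψ
q d = d χ xor d ψ

ω : (Tag → Bool) → (Tag → Bool) → Bool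
ω d e = (q d ∧ p e) xor (q e ∧ p d)

ω-cong : ∀ {d d′ e e′ : Tag → Bool} → (∀ x → d x ≡ d′ x) → (∀ x → e x ≡ e′ x) → ω d e ≡ ω d′ e′
ω-cong d≗d′ e≗e′ rewrite d≗d′ φ | d≗d′ χ | d≗d′ ψ | e≗e′ φ | e≗e′ χ | e≗e′ ψ = refl

ω-single-tag : ∀ t (d e : Tag → Bool) → (∀ t′ → t ≢ t′ → d t′ ≡ false) → (∀ t′ → t ≢ t′ → e t′ ≡ false) → ω d e ≡ false
ω-single-tag φ d e d≡0 e≡0 rewrite d≡0 χ (λ ()) | d≡0 ψ (λ ()) | e≡0 χ (λ ()) | e≡0 ψ (λ ()) = refl
ω-single-tag χ d e d≡0 e≡0 rewrite d≡0 φ (λ ()) | d≡0 ψ (λ ()) | e≡0 φ (λ ()) | e≡0 ψ (λ ()) =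
  cong₂ _xor_ (∧-zeroʳ (d χ xor false)) (∧-zeroʳ (e χ xor false))
ω-single-tag ψ d e d≡0 e≡0 rewrite d≡0 φ (λ ()) | d≡0 χ (λ ()) | e≡0 φ (λ ()) | e≡0 χ (λ ()) =
  trans (cong ((d ψ ∧ e ψ) xor_) (∧-comm (e ψ) (d ψ))) (xor-same (d ψ ∧ e ψ))

ω-distinct : ∀ {t t′} → t ≢ t′ → ω (λ x → ⌊ t ≟Tag x ⌋) (λ x → ⌊ t′ ≟Tag x ⌋) ≡ true
ω-distinct {φ} {φ} t≢t′ = contradiction refl t≢t′
ω-distinct {χ} {χ} t≢t′ = contradiction refl t≢t′
ω-distinct {ψ} {ψ} t≢t′ = contradiction refl t≢t′
ω-distinct {φ} {χ} _ = refl
ω-distinct {φ} {ψ} _ = refl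
ω-distinct {χ} {φ} _ = refl
ω-distinct {χ} {ψ} _ = refl
ω-distinct {ψ} {φ} _ = refl
ω-distinct {ψ} {χ} _ = refl

p-q-single-tag : ∀ t (d : Tag → Bool) → (∀ t′ → t ≢ t′ → d t′ ≡ false) → p d ≡ false → q d ≡ false → ∀ x → d x ≡ false
p-q-single-tag φ d d≡0 p≡0 _ φ = trans (xor≡false _ _ p≡0) (d≡0 ψ λ ())
p-q-single-tag χ d d≡0 _ q≡0 χ = trans (xor≡false _ _ q≡0) (d≡0 ψ λ ())
p-q-single-tag ψ d d≡0 p≡0 _ ψ = trans (sym (xor≡false _ _ p≡0)) (d≡0 φ λ ())
p-q-single-tag φ d d≡0 _ _ χ = d≡0 χ λ ()
p-q-single-tag φ d d≡0 _ _ ψ = d≡0 ψ λ ()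
p-q-single-tag χ d d≡0 _ _ φ = d≡0 φ λ ()
p-q-single-tag χ d d≡0 _ _ ψ = d≡0 ψ λ ()
p-q-single-tag ψ d d≡0 _ _ φ = d≡0 φ λ ()
p-q-single-tag ψ d d≡0 _ _ χ = d≡0 χ λ ()

sumFinV-sum : ∀ {k} m (F : Fin m → Vec2 k) i → sumFinV m F i ≡ ∑[ w < m ] F w i
sumFinV-sum zero F i = refl
sumFinV-sum (suc m) F i = cong (F zero i xor_) (sumFinV-sum m (F ∘ suc) i)

if-zeroV : ∀ {k} b (x : Vec2 k) i → (if b then x else zeroV) i ≡ b ∧ x i
if-zeroV true x i = refl
if-zeroV false x i = refl

module Graph {n} (G : LoopedSimpleGraph n) where

  col : W n → Vec2 n
  col = column G

  pV qV : SubsetW n → Vec2 n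
  pV D u = p (λ t → D (u , t))
  qV D u = q (λ t → D (u , t))

  A : Vec2 n → Vec2 n
  A x i = ∑[ u < n ] (adj G i u ∧ x u)

  A-self-adjoint : ∀ x y → x · A y ≡ y · A x
  A-self-adjoint x y = begin
    ∑[ i < n ] (x i ∧ A y i)                        ≡⟨ sum-cong-≋ {n} (λ i → *-distribˡ-sum (x i) (λ u → adj G i u ∧ y u)) ⟩
    ∑[ i < n ] ∑[ u < n ] (x i ∧ (adj G i u ∧ y u)) ≡⟨ ∑-comm (λ i u → x i ∧ (adj G i u ∧ y u)) ⟩
    ∑[ u < n ] ∑[ i < n ] (x i ∧ (adj G i u ∧ y u)) ≡⟨ sum-cong-≋ {n} (λ u → sum-cong-≋ {n} (λ i → swap (x i) (y u) (symmetric G i u))) ⟩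
    ∑[ u < n ] ∑[ i < n ] (y u ∧ (adj G u i ∧ x i)) ≡⟨ sum-cong-≋ {n} (λ u → sym (*-distribˡ-sum (y u) (λ i → adj G u i ∧ x i))) ⟩
    ∑[ u < n ] (y u ∧ A x u)                        ∎
    where
    open ≡-Reasoning
    rotate : ∀ a b c → a ∧ (c ∧ b) ≡ b ∧ (c ∧ a)
    rotate = solve-∀ 𝔽₂
    swap : ∀ a b {c d} → c ≡ d → a ∧ (c ∧ b) ≡ b ∧ (d ∧ a)
    swap a b {c} refl = rotate a b c

  lincomb-column : ∀ D i → lincomb col D i ≡ pV D i xor A (qV D) i
  lincomb-column D i = begin
    lincomb col D i                                              ≡⟨ sum-cong-≋ {n} (λ w → split (D (w , φ)) (D (w , χ)) (D (w , ψ)) (idM i w) (adj G i w)) ⟩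
    ∑[ w < n ] ((pV D w ∧ idM i w) xor (adj G i w ∧ qV D w))     ≡⟨ ∑-distrib-+ (λ w → pV D w ∧ idM i w) (λ w → adj G i w ∧ qV D w) ⟩
    ∑[ w < n ] (pV D w ∧ idM i w) xor A (qV D) i                 ≡⟨ cong (_xor A (qV D) i) (trans (sum-single _ i off-diagonal) on-diagonal) ⟩
    pV D i xor A (qV D) i                                        ∎
    where
    open ≡-Reasoning
    split : ∀ a b c x y → ((a ∧ x) xor (b ∧ y)) xor (c ∧ (x xor y)) ≡ ((a xor c) ∧ x) xor (y ∧ (b xor c))
    split = solve-∀ 𝔽₂
    off-diagonal : ∀ w → i ≢ w → pV D w ∧ idM i w ≡ false
    off-diagonal w i≢w = trans (cong (pV D w ∧_) (⌊⌋-no (i ≟ w) i≢w)) (∧-zeroʳ _)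
    on-diagonal : pV D i ∧ idM i i ≡ pV D i
    on-diagonal = trans (cong (pV D i ∧_) (⌊⌋-yes (i ≟ i) refl)) (∧-identityʳ _)

  sumCols≡lincomb : ∀ T i → sumCols G T i ≡ lincomb col T i
  sumCols≡lincomb T i = trans (sumFinV-sum n _ i) (sum-cong-≋ {n} λ w →
    trans (cong₂ _xor_ (if-zeroV (T (w , φ)) (col (w , φ)) i)
            (cong₂ _xor_ (if-zeroV (T (w , χ)) (col (w , χ)) i) (if-zeroV (T (w , ψ)) (col (w , ψ)) i)))
          (sym (xor-assoc (T (w , φ) ∧ col (w , φ) i) (T (w , χ) ∧ col (w , χ) i) (T (w , ψ) ∧ col (w , ψ) i))))

  Independent⇒IndependentOn : ∀ {Y} → Independent G Y → IndependentOn col Y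
  Independent⇒IndependentOn indep T T⊆Y T≡0 = indep T T⊆Y (λ i → trans (sumCols≡lincomb T i) (T≡0 i))

  IndependentOn⇒Independent : ∀ {Y} → IndependentOn col Y → Independent G Y
  IndependentOn⇒Independent indep T T⊆Y T≡0 = indep T T⊆Y (λ i → trans (sym (sumCols≡lincomb T i)) (T≡0 i))

  pairing : ∀ D E → (qV D · lincomb col E) xor (qV E · lincomb col D) ≡ ∑[ u < n ] ω (λ t → D (u , t)) (λ t → E (u , t))
  pairing D E = begin
    (qV D · lincomb col E) xor (qV E · lincomb col D)
      ≡⟨ cong₂ _xor_ (expand D E) (expand E D) ⟩
    ((qV D · pV E) xor (qV D · A (qV E))) xor ((qV E · pV D) xor (qV E · A (qV D)))
      ≡⟨ cong (λ x → ((qV D · pV E) xor x) xor ((qV E · pV D) xor (qV E · A (qV D)))) (A-self-adjoint (qV D) (qV E)) ⟩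
    ((qV D · pV E) xor (qV E · A (qV D))) xor ((qV E · pV D) xor (qV E · A (qV D)))
      ≡⟨ cancel (qV D · pV E) (qV E · pV D) (qV E · A (qV D)) ⟩
    (qV D · pV E) xor (qV E · pV D)
      ≡⟨ sym (∑-distrib-+ (λ u → qV D u ∧ pV E u) (λ u → qV E u ∧ pV D u)) ⟩
    ∑[ u < n ] ω (λ t → D (u , t)) (λ t → E (u , t))                                                  ∎
    where
    open ≡-Reasoning
    expand : ∀ D E → qV D · lincomb col E ≡ (qV D · pV E) xor (qV D · A (qV E))
    expand D E = trans (sum-cong-≋ {n} (λ i → cong (qV D i ∧_) (lincomb-column E i))) (·-xor-scale (qV D) (pV E) (A (qV E)) true)
    cancel : ∀ a b c → (a xor c) xor (b xor c) ≡ a xor b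
    cancel = solve-∀ 𝔽₂

  ω-vanishes : ∀ {R : SubsetW n} → Subtransversal R → ∀ (D E : SubsetW n) u →
    (∀ x → D (u , x) ≡ true → R (u , x) ≡ true) → (∀ x → E (u , x) ≡ true → R (u , x) ≡ true) →
    ω (λ t → D (u , t)) (λ t → E (u , t)) ≡ false
  ω-vanishes st D E u D⊆R E⊆R with Subtransversal-single-tag st u
  ... | t , R≡0 = ω-single-tag t _ _ (λ x t≢x → ⇒-false (D⊆R x) (R≡0 x t≢x)) (λ x t≢x → ⇒-false (E⊆R x) (R≡0 x t≢x))

  circuit-⊥-column : ∀ {R : SubsetW n} → Subtransversal R → ∀ (D : SubsetW n) → D ⊆W R → (∀ i → lincomb col D i ≡ false) →
    ∀ a → R a ≡ true → col a · qV D ≡ false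
  circuit-⊥-column st D D⊆R D≡0 a Ra = begin
    col a · qV D                                                  ≡⟨ ·-comm (col a) (qV D) ⟩
    qV D · col a                                                  ≡⟨ sum-cong-≋ {n} (λ i → cong (qV D i ∧_) (sym (lincomb-｛｝ col a i))) ⟩
    qV D · lincomb col ｛ a ｝                                      ≡⟨ sym (xor-identityʳ _) ⟩
    (qV D · lincomb col ｛ a ｝) xor false                          ≡⟨ cong ((qV D · lincomb col ｛ a ｝) xor_) (sym (·-zeroʳ (qV ｛ a ｝) D≡0)) ⟩
    (qV D · lincomb col ｛ a ｝) xor (qV ｛ a ｝ · lincomb col D)     ≡⟨ pairing D ｛ a ｝ ⟩
    ∑[ u < n ] ω (λ t → D (u , t)) (λ t → ｛ a ｝ (u , t))           ≡⟨ sum-zero _ (λ u → ω-vanishes st D ｛ a ｝ u (D⊆R ∘ (u ,_)) (｛｝⊆ Ra ∘ (u ,_))) ⟩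
    false                                                         ∎
    where
    open ≡-Reasoning

  p-q-empty : ∀ {R : SubsetW n} → Subtransversal R → ∀ (D : SubsetW n) → D ⊆W R → (∀ u → pV D u ≡ false) → (∀ u → qV D u ≡ false) → ∀ e → D e ≡ false
  p-q-empty st D D⊆R p≡0 q≡0 (u , x) with Subtransversal-single-tag st u
  ... | t , R≡0 = p-q-single-tag t (λ t → D (u , t)) (λ x t≢x → ⊆-false D⊆R (R≡0 x t≢x)) (p≡0 u) (q≡0 u) x

  -- The circuits T s △ ｛ s ｝ have independent q-parts: a vanishing sum S of them would be a dependency of
  -- a subset of R with p(S) = q(S) = 0, hence empty, while S contains the chosen s.
  q-independent : ∀ {R Y N : SubsetW n} → Subtransversal R → Y ⊆W R → N ⊆W R → (∀ e → N e ≡ true → Y e ≡ false) →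
    (T : W n → SubsetW n) → (∀ s → N s ≡ true → T s ⊆W Y) → (∀ s → N s ≡ true → ∀ i → lincomb col (T s) i ≡ col s i) →
    IndependentOn (λ s → qV (T s △ ｛ s ｝)) N
  q-independent {R} {Y} {N} st Y⊆R N⊆R N∩Y≡∅ T T⊆Y T-spans L L⊆N qL≡0 s₀ with L s₀ in Ls₀
  ... | false = refl
  ... | true = contradiction (trans (sym Ls₀) (trans (sym (S-on-N s₀ (L⊆N s₀ Ls₀))) (S≡∅ s₀))) λ ()
    where
    D : W n → SubsetW n
    D s = T s △ ｛ s ｝
    S : SubsetW n
    S e = ∑W (λ s → L s ∧ D s e)

    lincomb-S : ∀ i → lincomb col S i ≡ false
    lincomb-S i = trans (lincomb-∑W col L D i)
      (∑W-zero _ (∧-vanishes (λ s → lincomb col (D s) i) L⊆N (λ s Ns → span⇒circuit col (T s) s (T-spans s Ns) i)))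
    qS : ∀ u → qV S u ≡ false
    qS u = trans (sym (∑W-distrib (λ s → L s ∧ D s (u , χ)) (λ s → L s ∧ D s (u , ψ))))
      (trans (∑W-cong (λ s → sym (∧-distribˡ-xor (L s) (D s (u , χ)) (D s (u , ψ))))) (qL≡0 u))
    pS : ∀ u → pV S u ≡ false
    pS u = begin
      pV S u                          ≡⟨ sym (xor-identityʳ _) ⟩
      pV S u xor false                ≡⟨ cong (pV S u xor_) (sym (sum-zero _ (λ w → trans (cong (adj G u w ∧_) (qS w)) (∧-zeroʳ _)))) ⟩
      pV S u xor A (qV S) u           ≡⟨ sym (lincomb-column S u) ⟩
      lincomb col S u                 ≡⟨ lincomb-S u ⟩
      false                           ∎
      where open ≡-Reasoning
    S⊆R : S ⊆W R
    S⊆R e Se with ∑W-true _ Se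
    ... | s , LsDse with ∧≡true (L s) (D s e) LsDse
    ...   | Ls , Dse with xor≡true (T s e) _ Dse
    ...     | inj₁ Tse = Y⊆R e (T⊆Y s (L⊆N s Ls) e Tse)
    ...     | inj₂ s≡e = ｛｝⊆ (N⊆R s (L⊆N s Ls)) e s≡e
    S≡∅ : ∀ e → S e ≡ false
    S≡∅ = p-q-empty st S S⊆R pS qS
    S-on-N : ∀ s₀ → N s₀ ≡ true → S s₀ ≡ L s₀
    S-on-N s₀ Ns₀ = ∑W-△-｛｝ L T s₀ (λ s Ls → ⊆-false (T⊆Y s (L⊆N s Ls)) (N∩Y≡∅ s₀ Ns₀))

  at-most-one-tag-spanned : ∀ {S : SubsetW n} → Subtransversal S → ∀ {v} → (∀ t → S (v , t) ≡ false) →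
    ∀ {t t′} → t ≢ t′ → InSpan col S (col (v , t)) → InSpan col S (col (v , t′)) → ⊥
  at-most-one-tag-spanned {S} st {v} Sv≡0 {t} {t′} t≢t′ (T₁ , T₁⊆S , T₁-spans) (T₂ , T₂⊆S , T₂-spans) =
    contradiction (begin
      true                                                         ≡⟨ sym (ω-distinct t≢t′) ⟩
      ω (λ x → ⌊ t ≟Tag x ⌋) (λ x → ⌊ t′ ≟Tag x ⌋)                   ≡⟨ sym (ω-cong (at-v T₁ t T₁⊆S) (at-v T₂ t′ T₂⊆S)) ⟩
      ω (λ x → D (v , x)) (λ x → E (v , x))                        ≡⟨ sym (sum-single _ v off-v) ⟩
      ∑[ u < n ] ω (λ x → D (u , x)) (λ x → E (u , x))             ≡⟨ sym (pairing D E) ⟩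
      (qV D · lincomb col E) xor (qV E · lincomb col D)            ≡⟨ cong₂ _xor_ (·-zeroʳ (qV D) E-circuit) (·-zeroʳ (qV E) D-circuit) ⟩
      false                                                        ∎) λ ()
    where
    open ≡-Reasoning
    D E : SubsetW n
    D = T₁ △ ｛ (v , t) ｝
    E = T₂ △ ｛ (v , t′) ｝
    D-circuit : ∀ i → lincomb col D i ≡ false
    D-circuit = span⇒circuit col T₁ (v , t) T₁-spans
    E-circuit : ∀ i → lincomb col E i ≡ false
    E-circuit = span⇒circuit col T₂ (v , t′) T₂-spans
    at-v : ∀ T s → T ⊆W S → ∀ x → (T △ ｛ (v , s) ｝) (v , x) ≡ ⌊ s ≟Tag x ⌋
    at-v T s T⊆S x = cong₂ _xor_ (⊆-false T⊆S (Sv≡0 x)) (｛｝-tag v s x)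
    off-v-⊆ : ∀ T s → T ⊆W S → ∀ u → v ≢ u → ∀ x → (T △ ｛ (v , s) ｝) (u , x) ≡ true → S (u , x) ≡ true
    off-v-⊆ T s T⊆S u v≢u x T△ = T⊆S (u , x) (trans (sym (trans (cong (T (u , x) xor_) (｛｝-≢ (v≢u ∘ ,-injectiveˡ))) (xor-identityʳ _))) T△)
    off-v : ∀ u → v ≢ u → ω (λ x → D (u , x)) (λ x → E (u , x)) ≡ false
    off-v u v≢u = ω-vanishes st D E u (off-v-⊆ T₁ t T₁⊆S u v≢u) (off-v-⊆ T₂ t′ T₂⊆S u v≢u)

+-suc-≤-cancel : ∀ a b c → a + suc c ≤ suc (b + c) → a ≤ b
+-suc-≤-cancel a b c h = +-cancelʳ-≤ c a b (≤-pred (subst (_≤ suc (b + c)) (+-suc a c) h))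

module Rank {n} (G : LoopedSimpleGraph n) {S Y : SubsetW n} (st : Subtransversal S) {v : Fin n} (Sv≡0 : ∀ t → S (v , t) ≡ false)
  (Y⊆S : Y ⊆W S) (indepY : IndependentOn (column G) Y)
  (maxY : ∀ Z → Z ⊆W S → IndependentOn (column G) Z → size Z ≤ size Y) (|S|+1≡n : suc (size S) ≡ n) where

  open Graph G

  R : Tag → SubsetW n
  R t = S ∪ ｛ (v , t) ｝

  S⊆R : ∀ t → S ⊆W R t
  S⊆R t = ⊆-∪ˡ {X = S}

  v⊆R : ∀ t → ｛ (v , t) ｝ ⊆W R t
  v⊆R t = ⊆-∪ʳ {X = S}

  Y⊆R : ∀ t → Y ⊆W R t
  Y⊆R t e = S⊆R t e ∘ Y⊆S e

  S⊆span : ∀ s → S s ≡ true → InSpan col Y (col s)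
  S⊆span s Ss with InSpan? col Y (col s)
  ... | yes spanned = spanned
  ... | no s∉span with Y s in Ys
  ...   | true = contradiction (｛ s ｝ , ｛｝⊆ Ys , lincomb-｛｝ col s) s∉span
  ...   | false = contradiction (subst (_≤ size Y) (size-∪-｛｝ Y s Ys)
                    (maxY (Y ∪ ｛ s ｝) (∪-⊆ Y⊆S (｛｝⊆ Ss)) (independent-∪-｛｝ col Y s indepY s∉span))) 1+n≰n

  spanner : W n → SubsetW n
  spanner s with InSpan? col Y (col s)
  ... | yes (T , _) = T
  ... | no _ = λ _ → false

  spanner-spans : ∀ s → InSpan col Y (col s) → spanner s ⊆W Y × (∀ i → lincomb col (spanner s) i ≡ col s i)
  spanner-spans s spanned with InSpan? col Y (col s)
  ... | yes (_ , spec) = spec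
  ... | no s∉span = contradiction spanned s∉span

  qf : W n → Vec2 n
  qf s = qV (spanner s △ ｛ s ｝)

  Spanned : SubsetW n → Set
  Spanned N = ∀ s → N s ≡ true → InSpan col Y (col s)

  q-orthogonal : ∀ t {N} → N ⊆W R t → Spanned N → ∀ a s → R t a ≡ true → N s ≡ true → col a · qf s ≡ false
  q-orthogonal t {N} N⊆R spanned a s Ra Ns = circuit-⊥-column (Subtransversal-∪-｛｝ st Sv≡0 t) (spanner s △ ｛ s ｝)
    circuit⊆R (span⇒circuit col (spanner s) s (proj₂ spec)) a Ra
    where
    spec : spanner s ⊆W Y × (∀ i → lincomb col (spanner s) i ≡ col s i)
    spec = spanner-spans s (spanned s Ns)
    circuit⊆R : (spanner s △ ｛ s ｝) ⊆W R t
    circuit⊆R e in-circuit with xor≡true (spanner s e) _ in-circuit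
    ... | inj₁ in-spanner = S⊆R t e (Y⊆S e (proj₁ spec e in-spanner))
    ... | inj₂ s≡e = ｛｝⊆ (N⊆R s Ns) e s≡e

  size-bound : ∀ t {Z N} → IndependentOn col Z → N ⊆W R t → Spanned N → (∀ e → N e ≡ true → Y e ≡ false) →
    (∀ a s → Z a ≡ true → N s ≡ true → col a · qf s ≡ false) → size Z + size N ≤ n
  size-bound t indepZ N⊆R spanned N∩Y≡∅ orth = dimension-bound n col qf _ _ indepZ
    (q-independent (Subtransversal-∪-｛｝ st Sv≡0 t) (Y⊆R t) N⊆R N∩Y≡∅ spanner
      (λ s Ns → proj₁ (spanner-spans s (spanned s Ns))) (λ s Ns → proj₂ (spanner-spans s (spanned s Ns))))
    orth

  N₀ : SubsetW n
  N₀ = S ∖ Y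

  N₀⊆S : N₀ ⊆W S
  N₀⊆S = ∖-⊆ {X = S}

  N₀∩Y≡∅ : ∀ e → N₀ e ≡ true → Y e ≡ false
  N₀∩Y≡∅ e N₀e = trans (sym (Bool.not-involutive (Y e))) (cong not (proj₂ (∧≡true (S e) _ N₀e)))

  n≡1+|Y|+|N₀| : n ≡ suc (size Y + size N₀)
  n≡1+|Y|+|N₀| = trans (sym |S|+1≡n) (cong suc (trans (size-∩-∖ S Y) (cong (_+ size N₀) (size-≗ S∩Y≗Y))))
    where
    S∩Y≗Y : ∀ e → (S ∩ Y) e ≡ Y e
    S∩Y≗Y e with Y e in Ye
    ... | true = trans (cong (_∧ true) (Y⊆S e Ye)) refl
    ... | false = ∧-zeroʳ (S e)

  N₀⊆R : ∀ t → N₀ ⊆W R t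
  N₀⊆R t e = S⊆R t e ∘ N₀⊆S e

  N₀-spanned : Spanned N₀
  N₀-spanned s N₀s = S⊆span s (N₀⊆S s N₀s)

  rank-if-spanned : ∀ t → InSpan col Y (col (v , t)) → IsRank G (R t) (size Y)
  rank-if-spanned t spanned = (Y , (Y⊆R t) , IndependentOn⇒Independent indepY , refl) , bound
    where
    N : SubsetW n
    N = N₀ ∪ ｛ (v , t) ｝
    N₀v≡0 : N₀ (v , t) ≡ false
    N₀v≡0 = ⊆-false N₀⊆S (Sv≡0 t)
    N-spanned : Spanned N
    N-spanned s Ns with ∨≡true (N₀ s) _ Ns
    ... | inj₁ N₀s = N₀-spanned s N₀s
    ... | inj₂ v≡s = subst (λ x → InSpan col Y (col x)) (｛｝-≡ v≡s) spanned
    N∩Y≡∅ : ∀ e → N e ≡ true → Y e ≡ false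
    N∩Y≡∅ e Ne with ∨≡true (N₀ e) _ Ne
    ... | inj₁ N₀e = N₀∩Y≡∅ e N₀e
    ... | inj₂ v≡e = subst (λ x → Y x ≡ false) (｛｝-≡ v≡e) (⊆-false Y⊆S (Sv≡0 t))
    N⊆R : N ⊆W R t
    N⊆R = ∪-⊆ (N₀⊆R t) (v⊆R t)
    bound : ∀ Z → Z ⊆W R t → Independent G Z → size Z ≤ size Y
    bound Z Z⊆R indepZ = +-suc-≤-cancel (size Z) (size Y) (size N₀)
      (subst₂ (λ a b → size Z + a ≤ b) (size-∪-｛｝ N₀ (v , t) N₀v≡0) n≡1+|Y|+|N₀|
        (size-bound t (Independent⇒IndependentOn indepZ) N⊆R N-spanned N∩Y≡∅
          (λ a s Za Ns → q-orthogonal t N⊆R N-spanned a s (Z⊆R a Za) Ns)))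

  rank-if-not-spanned : ∀ t → ¬ InSpan col Y (col (v , t)) → IsRank G (R t) (suc (size Y))
  rank-if-not-spanned t not-spanned =
    (Y ∪ ｛ (v , t) ｝ , ∪-⊆ (Y⊆R t) (v⊆R t) ,
     IndependentOn⇒Independent (independent-∪-｛｝ col Y (v , t) indepY not-spanned) ,
     size-∪-｛｝ Y (v , t) (⊆-false Y⊆S (Sv≡0 t))) ,
    bound
    where
    bound : ∀ Z → Z ⊆W R t → Independent G Z → size Z ≤ suc (size Y)
    bound Z Z⊆R indepZ = ≤-trans (size-≤-∖-｛｝ Z (v , t))
      (s≤s (maxY (Z ∖ ｛ (v , t) ｝) Z∖v⊆S (IndependentOn-⊆ {f = col} Z∖v⊆Z (Independent⇒IndependentOn indepZ))))
      where
      Z∖v⊆Z : (Z ∖ ｛ (v , t) ｝) ⊆W Z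
      Z∖v⊆Z = ∖-⊆ {X = Z}
      Z∖v⊆S : (Z ∖ ｛ (v , t) ｝) ⊆W S
      Z∖v⊆S e Z∖v = ∪-｛｝-elim {X = S} (Z⊆R e (Z∖v⊆Z e Z∖v)) (∖-｛｝-≢ {X = Z} Z∖v)

  some-tag-spanned : Σ Tag (λ t → InSpan col Y (col (v , t)))
  some-tag-spanned with any?Tag (λ t → InSpan? col Y (col (v , t)))
  ... | yes spanned = spanned
  ... | no none = contradiction (size-bound φ indepX₂ (N₀⊆R φ) N₀-spanned N₀∩Y≡∅ orth) too-big
    where
    not-spanned : ∀ t → ¬ InSpan col Y (col (v , t))
    not-spanned t spanned = none (t , spanned)
    X₁ X₂ : SubsetW n
    X₁ = Y ∪ ｛ (v , φ) ｝
    X₂ = X₁ ∪ ｛ (v , χ) ｝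
    χ∉span-X₁ : ¬ InSpan col X₁ (col (v , χ))
    χ∉span-X₁ spanned with InSpan-∪-｛｝ col Y (v , φ) (col (v , χ)) spanned
    ... | inj₁ χ-spanned = not-spanned χ χ-spanned
    ... | inj₂ (T , T⊆Y , T-spans) = not-spanned ψ (T , T⊆Y , λ i → trans (T-spans i) (xor-comm (adj G i v) (idM i v)))
    X₁v≡0 : X₁ (v , χ) ≡ false
    X₁v≡0 = cong₂ _∨_ (⊆-false Y⊆S (Sv≡0 χ)) (｛｝-≢ λ ())
    indepX₂ : IndependentOn col X₂
    indepX₂ = independent-∪-｛｝ col X₁ (v , χ) (independent-∪-｛｝ col Y (v , φ) indepY (not-spanned φ)) χ∉span-X₁
    orth : ∀ a s → X₂ a ≡ true → N₀ s ≡ true → col a · qf s ≡ false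
    orth a s X₂a N₀s with ∨≡true (X₁ a) _ X₂a
    ... | inj₂ vχ = q-orthogonal χ (N₀⊆R χ) N₀-spanned a s (v⊆R χ a vχ) N₀s
    ... | inj₁ X₁a with ∨≡true (Y a) _ X₁a
    ...   | inj₁ Ya = q-orthogonal φ (N₀⊆R φ) N₀-spanned a s (S⊆R φ a (Y⊆S a Ya)) N₀s
    ...   | inj₂ vφ = q-orthogonal φ (N₀⊆R φ) N₀-spanned a s (v⊆R φ a vφ) N₀s
    too-big : ¬ (size X₂ + size N₀ ≤ n)
    too-big h = 1+n≰n (subst₂ (λ a b → a + size N₀ ≤ b)
      (trans (size-∪-｛｝ X₁ (v , χ) X₁v≡0) (cong suc (size-∪-｛｝ Y (v , φ) (⊆-false Y⊆S (Sv≡0 φ))))) n≡1+|Y|+|N₀| h)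

  result : Σ Tag (λ t → IsRank G (R t) (size Y) × (∀ t′ → t′ ≢ t → IsRank G (R t′) (suc (size Y))))
  result with some-tag-spanned
  ... | t , spanned = t , rank-if-spanned t spanned , λ t′ t′≢t → rank-if-not-spanned t′ λ spanned′ →
    at-most-one-tag-spanned st Sv≡0 t′≢t (InSpan-⊆ {f = col} Y⊆S spanned′) (InSpan-⊆ {f = col} Y⊆S spanned)

IsRank-≗ : ∀ {n} (G : LoopedSimpleGraph n) {X X′ : SubsetW n} {k} → (∀ e → X e ≡ X′ e) → IsRank G X k → IsRank G X′ k
IsRank-≗ G X≗X′ ((Y , Y⊆X , indepY , |Y|≡k) , maxY) =
  (Y , (λ e → trans (sym (X≗X′ e)) ∘ Y⊆X e) , indepY , |Y|≡k) , λ Z Z⊆X′ → maxY Z (λ e → trans (X≗X′ e) ∘ Z⊆X′ e)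

theorem41 : (n : ℕ) (G : LoopedSimpleGraph n) (S : SubsetW n) →
    Subtransversal S → size S ≡ n ∸ 1 →
    (v : Fin n) → (∀ t → S (v , t) ≡ false) →
    (k : ℕ) → IsRank G S k →
    Σ Tag (λ t → IsRank G (insertW S (v , t)) k ×
      (∀ t' → ¬ t' ≡ t → IsRank G (insertW S (v , t')) (suc k)))
theorem41 zero _ _ _ _ ()
theorem41 (suc n) G S st |S|≡n v Sv≡0 .(size Y) ((Y , Y⊆S , indepY , refl) , maxY) =
  let t , rank , ranks = Rank.result G st Sv≡0 Y⊆S (Independent⇒IndependentOn indepY)
                           (λ Z Z⊆S → maxY Z Z⊆S ∘ IndependentOn⇒Independent) (cong suc |S|≡n)
  in t , IsRank-≗ G (sym ∘ insertW-≗ S (v , t)) rank ,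
     λ t′ t′≢t → IsRank-≗ G (sym ∘ insertW-≗ S (v , t′)) (ranks t′ t′≢t)
  where open Graph G using (Independent⇒IndependentOn; IndependentOn⇒Independent)
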